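{- Let $n,s,t\in\mathbb{N}$ with $1\le s\le t\le n$, $t\ge 2s$ and $s\ge n-t$. Then the number $\mathcal{M}(n,s,t)$ of monochromatic Schur triples on $[n]$ under the coloring $R^sB^{t-s}R^{n-t}$ is \[ \mathcal{M}(n,s,t)=\frac{s(s-1)}{2}+\frac{(t-2s)(t-2s-1)}{2}+(n-t)(n-t-1). \]
   Context: $[n]=\{1,\dots,n\}$. The coloring $R^sB^{t-s}R^{n-t}$ of $[n]$ colors $1,\dots,s$ and $t+1,\dots,n$ red and $s+1,\dots,t$ blue. A monochromatic Schur triple is an ordered triple $(x,y,z)\in[n]^3$ with $z=x+y$ and $x,y,z$ of the same color; $(x,y,x+y)$ and $(y,x,x+y)$ count as distinct when $x\ne y$. -}

module Defs where

open import Data.Nat using (ℕ; zero; suc; _+_; _≤ᵇ_)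
open import Data.Bool using (Bool; true; false; _∧_; if_then_else_)
open import Data.List using (List; map; applyUpTo)
open import Data.Nat.ListAction using (sum)

data Colour : Set where
  R B : Colour

_==ᶜ_ : Colour → Colour → Bool
R ==ᶜ R = true
B ==ᶜ B = true
_ ==ᶜ _ = false

colour : (s t x : ℕ) → Colour
colour s t x = if x ≤ᵇ s then R else (if x ≤ᵇ t then B else R)

range1 : ℕ → List ℕ
range1 n = applyUpTo suc n

-- is (x, y, x+y) a monochromatic Schur triple in [n]^3 ?
-- (x, y ∈ [n] come from the enumeration; need x + y ≤ n.)
isMonoSchur : (n s t x y : ℕ) → Bool
isMonoSchur n s t x y =
  ((x + y) ≤ᵇ n) ∧ ((colour s t x ==ᶜ colour s t y) ∧ (colour s t x ==ᶜ colour s t (x + y)))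

count : Bool → ℕ
count true = 1
count false = 0

-- number of ordered monochromatic Schur triples (x, y, z) ∈ [n]^3, z = x + y
M : (n s t : ℕ) → ℕ
M n s t = sum (map (λ x → sum (map (λ y → count (isMonoSchur n s t x y)) (range1 n))) (range1 n))

module Submission where

-- Write M n s t as a double sum over x, y ∈ [n] and cut both
-- ranges into the three colour blocks L = [1,s] (red), C = (s,t] (blue) and
-- H = (t,n] (red).  Under t ≥ 2s and n - t ≤ s each block pair behaves simply:
-- for fixed x, the y in a block of the other colour contribute nothing, and in
-- the remaining blocks (x,y,x+y) is monochromatic exactly when x + y ≤ m for a
-- block-dependent bound m (m = s for L×L, m = n for L×H and H×L, m = t for
-- C×C; H×H never, as x + y > t + s ≥ n).  So each row is a threshold count,
-- giving s-x + (n-t)-x on L, t-s-x on C and n-x on H.  Summing these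
-- decreasing sequences gives triangular numbers, and the theorem follows from
-- tri k = k(k-1)/2.
-- The file develops: interval sums, threshold and triangular counts, the
-- colouring and the Schur predicate on a block, the three row values, and
-- finally the theorem.

open import Defs
open import Data.Nat using (ℕ; _+_; _*_; _∸_; _≤_; _/_)
open import Relation.Binary.PropositionalEquality using (_≡_)

open import Data.Nat using (zero; suc; _<_; _≤ᵇ_; z≤n; s≤s⁻¹; _≤?_)
open import Data.Nat.Properties
open import Data.Nat.DivMod using (m*n/n≡m)
open import Data.Nat.Solver using (module +-*-Solver)
open import Data.Bool using (false; true)
open import Data.Bool.Properties using (∧-zeroʳ; T-≡)
open import Data.List using (map; applyUpTo)
open import Data.Nat.ListAction using (sum)
open import Function.Bundles using (module Equivalence)
open import Relation.Nullary using (yes; no)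
open import Relation.Nullary.Negation using (contradiction)
open import Relation.Binary.PropositionalEquality
  using (_≢_; refl; sym; trans; cong; cong₂; module ≡-Reasoning)
open +-*-Solver using (solve; _:+_; _:*_; _:=_; con)

-- Σ⟨ a , k ⟩ f = f (a+1) + … + f (a+k), the sum of f over (a, a+k].
Σ⟨_,_⟩_ : ℕ → ℕ → (ℕ → ℕ) → ℕ
Σ⟨ a , zero ⟩ f = 0
Σ⟨ a , suc k ⟩ f = f (suc a) + Σ⟨ suc a , k ⟩ f

sum-applyUpTo : ∀ k a (f g : ℕ → ℕ) → (∀ i → g i ≡ suc (a + i)) →
                sum (map f (applyUpTo g k)) ≡ Σ⟨ a , k ⟩ f
sum-applyUpTo zero a f g g≗ = refl
sum-applyUpTo (suc k) a f g g≗ =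
  cong₂ _+_ (cong f (trans (g≗ 0) (cong suc (+-identityʳ a))))
            (sum-applyUpTo k (suc a) f (λ i → g (suc i))
               (λ i → trans (g≗ (suc i)) (cong suc (+-suc a i))))

Σ-cong : ∀ a k (f g : ℕ → ℕ) → (∀ i → a < i → i ≤ a + k → f i ≡ g i) →
         Σ⟨ a , k ⟩ f ≡ Σ⟨ a , k ⟩ g
Σ-cong a zero f g f≗g = refl
Σ-cong a (suc k) f g f≗g =
  cong₂ _+_ (f≗g (suc a) ≤-refl (≤-trans (m≤m+n (suc a) k) (≤-reflexive (sym (+-suc a k)))))
            (Σ-cong (suc a) k f g (λ i a<i i≤ → f≗g i (<-trans (n<1+n a) a<i)
                                              (≤-trans i≤ (≤-reflexive (sym (+-suc a k))))))

Σ-zero : ∀ a k (f : ℕ → ℕ) → (∀ i → a < i → i ≤ a + k → f i ≡ 0) → Σ⟨ a , k ⟩ f ≡ 0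
Σ-zero a k f f≗0 = trans (Σ-cong a k f (λ _ → 0) f≗0) (Σ-zeros a k)
  where
  Σ-zeros : ∀ a k → Σ⟨ a , k ⟩ (λ _ → 0) ≡ 0
  Σ-zeros a zero = refl
  Σ-zeros a (suc k) = Σ-zeros (suc a) k

Σ-+ : ∀ a k (f g : ℕ → ℕ) → Σ⟨ a , k ⟩ (λ x → f x + g x) ≡ Σ⟨ a , k ⟩ f + Σ⟨ a , k ⟩ g
Σ-+ a zero f g = refl
Σ-+ a (suc k) f g =
  trans (cong (f (suc a) + g (suc a) +_) (Σ-+ (suc a) k f g))
        (interchange (f (suc a)) (g (suc a)) (Σ⟨ suc a , k ⟩ f) (Σ⟨ suc a , k ⟩ g))
  where
  interchange : ∀ p q r u → (p + q) + (r + u) ≡ (p + r) + (q + u)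
  interchange = solve 4 (λ p q r u → (p :+ q) :+ (r :+ u) := (p :+ r) :+ (q :+ u)) refl

Σ-split : ∀ a k b (f : ℕ → ℕ) → b ≤ k → Σ⟨ a , k ⟩ f ≡ Σ⟨ a , b ⟩ f + Σ⟨ a + b , k ∸ b ⟩ f
Σ-split a k zero f _ rewrite +-identityʳ a = refl
Σ-split a (suc k) (suc b) f b≤k rewrite +-suc a b =
  trans (cong (f (suc a) +_) (Σ-split (suc a) k b f (s≤s⁻¹ b≤k)))
        (sym (+-assoc (f (suc a)) _ _))

≤ᵇ-true : ∀ {m n} → m ≤ n → (m ≤ᵇ n) ≡ true
≤ᵇ-true m≤n = Equivalence.to T-≡ (≤⇒≤ᵇ m≤n)

≤ᵇ-false : ∀ {m n} → n < m → (m ≤ᵇ n) ≡ false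
≤ᵇ-false {m} {n} n<m with m ≤ᵇ n in eq
... | false = refl
... | true  = contradiction (≤ᵇ⇒≤ m n (Equivalence.from T-≡ eq)) (<⇒≱ n<m)

count-step : ∀ m a → count (suc a ≤ᵇ m) + (m ∸ suc a) ≡ m ∸ a
count-step zero    zero    = refl
count-step (suc m) zero    = refl
count-step zero    (suc a) = refl
count-step (suc m) (suc a) = count-step m a

threshold-count : ∀ a k m → m ≤ a + k → Σ⟨ a , k ⟩ (λ y → count (y ≤ᵇ m)) ≡ m ∸ a
threshold-count a zero m m≤ = sym (m≤n⇒m∸n≡0 (≤-trans m≤ (≤-reflexive (+-identityʳ a))))
threshold-count a (suc k) m m≤ =
  trans (cong (count (suc a ≤ᵇ m) +_)
              (threshold-count (suc a) k m (≤-trans m≤ (≤-reflexive (+-suc a k)))))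
        (count-step m a)

row-count : ∀ x m a k (f : ℕ → ℕ) → m ∸ x ≤ a + k →
            (∀ y → a < y → y ≤ a + k → x + y ≤ m → f y ≡ 1) →
            (∀ y → a < y → y ≤ a + k → m < x + y → f y ≡ 0) →
            Σ⟨ a , k ⟩ f ≡ m ∸ x ∸ a
row-count x m a k f bound below above =
  trans (Σ-cong a k f _ indicator) (threshold-count a k (m ∸ x) bound)
  where
  indicator : ∀ y → a < y → y ≤ a + k → f y ≡ count (y ≤ᵇ (m ∸ x))
  indicator y a<y y≤ with y ≤? m ∸ x
  ... | yes y≤m∸x = trans (below y a<y y≤ (x+y≤m y≤m∸x)) (cong count (sym (≤ᵇ-true y≤m∸x)))
    where
    -- y ≥ 1 forces m - x > 0, so x ≤ m and the truncated subtraction is exact.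
    x+y≤m : y ≤ m ∸ x → x + y ≤ m
    x+y≤m y≤ with x ≤? m
    ... | yes x≤m = ≤-trans (+-monoʳ-≤ x y≤) (≤-reflexive (m+[n∸m]≡n x≤m))
    ... | no  x≰m = contradiction (≤-trans y≤ (≤-reflexive (m≤n⇒m∸n≡0 (<⇒≤ (≰⇒> x≰m)))))
                                  (<⇒≱ (≤-<-trans z≤n a<y))
  ... | no  y≰m∸x = trans (above y a<y y≤ m<x+y) (cong count (sym (≤ᵇ-false (≰⇒> y≰m∸x))))
    where
    m<x+y : m < x + y
    m<x+y = ≤-<-trans (m≤n+m∸n m x) (+-monoʳ-< x (≰⇒> y≰m∸x))

tri : ℕ → ℕ
tri zero = 0
tri (suc k) = k + tri k

-- Removing the largest summand, in a form valid also when m ≤ a.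
tri-step : ∀ m a → tri (m ∸ a) ≡ (m ∸ suc a) + tri (m ∸ suc a)
tri-step zero    zero    = refl
tri-step (suc m) zero    = refl
tri-step zero    (suc a) = refl
tri-step (suc m) (suc a) = tri-step m a

Σ-decreasing : ∀ a k m → m ≤ a + k → Σ⟨ a , k ⟩ (m ∸_) ≡ tri (m ∸ a)
Σ-decreasing a zero m m≤ =
  sym (cong tri (m≤n⇒m∸n≡0 (≤-trans m≤ (≤-reflexive (+-identityʳ a)))))
Σ-decreasing a (suc k) m m≤ =
  trans (cong (m ∸ suc a +_) (Σ-decreasing (suc a) k m (≤-trans m≤ (≤-reflexive (+-suc a k)))))
        (sym (tri-step m a))

tri-double : ∀ k → tri k + tri k ≡ k * (k ∸ 1)
tri-double zero = refl
tri-double (suc zero) = refl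
tri-double (suc (suc j)) = begin
  (suc j + tri (suc j)) + (suc j + tri (suc j))  ≡⟨ interchange (suc j) (tri (suc j)) ⟩
  (suc j + suc j) + (tri (suc j) + tri (suc j))  ≡⟨ cong (suc j + suc j +_) (tri-double (suc j)) ⟩
  (suc j + suc j) + suc j * j                    ≡⟨ expand j ⟩
  suc (suc j) * suc j                            ∎
  where
  open ≡-Reasoning
  interchange : ∀ p q → (p + q) + (p + q) ≡ (p + p) + (q + q)
  interchange = solve 2 (λ p q → (p :+ q) :+ (p :+ q) := (p :+ p) :+ (q :+ q)) refl
  expand : ∀ j → (suc j + suc j) + suc j * j ≡ suc (suc j) * suc j
  expand = solve 1 (λ j → ((con 1 :+ j) :+ (con 1 :+ j)) :+ (con 1 :+ j) :* j
                          := (con 2 :+ j) :* (con 1 :+ j)) refl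

tri-half : ∀ k → (k * (k ∸ 1)) / 2 ≡ tri k
tri-half k = begin
  (k * (k ∸ 1)) / 2      ≡⟨ cong (_/ 2) (sym (tri-double k)) ⟩
  (tri k + tri k) / 2    ≡⟨ cong (_/ 2) (trans (cong (tri k +_) (sym (+-identityʳ (tri k))))
                                                 (*-comm 2 (tri k))) ⟩
  (tri k * 2) / 2        ≡⟨ m*n/n≡m (tri k) 2 ⟩
  tri k                  ∎
  where open ≡-Reasoning

==ᶜ-refl : ∀ c → (c ==ᶜ c) ≡ true
==ᶜ-refl R = refl
==ᶜ-refl B = refl

==ᶜ-≢ : ∀ {c d} → c ≢ d → (c ==ᶜ d) ≡ false
==ᶜ-≢ {R} {R} c≢d = contradiction refl c≢d
==ᶜ-≢ {R} {B} c≢d = refl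
==ᶜ-≢ {B} {R} c≢d = refl
==ᶜ-≢ {B} {B} c≢d = contradiction refl c≢d

R≢B : R ≢ B
R≢B ()

B≢R : B ≢ R
B≢R ()

module Triples (n s t : ℕ) where

  colour-low : ∀ {x} → x ≤ s → colour s t x ≡ R
  colour-low {x} x≤s rewrite ≤ᵇ-true x≤s = refl

  colour-mid : ∀ {x} → s < x → x ≤ t → colour s t x ≡ B
  colour-mid {x} s<x x≤t rewrite ≤ᵇ-false s<x | ≤ᵇ-true x≤t = refl

  colour-high : ∀ {x} → s ≤ t → t < x → colour s t x ≡ R
  colour-high {x} s≤t t<x rewrite ≤ᵇ-false (≤-<-trans s≤t t<x) | ≤ᵇ-false t<x = refl

  mono-yes : ∀ x y {c} → x + y ≤ n → colour s t x ≡ c → colour s t y ≡ c →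
             colour s t (x + y) ≡ c → count (isMonoSchur n s t x y) ≡ 1
  mono-yes x y {c} x+y≤n cx cy cz rewrite ≤ᵇ-true x+y≤n | cx | cy | cz | ==ᶜ-refl c = refl

  mono-too-big : ∀ x y → n < x + y → count (isMonoSchur n s t x y) ≡ 0
  mono-too-big x y n<x+y rewrite ≤ᵇ-false n<x+y = refl

  mono-mixed-summands : ∀ x y {c d} → colour s t x ≡ c → colour s t y ≡ d → c ≢ d →
                        count (isMonoSchur n s t x y) ≡ 0
  mono-mixed-summands x y cx cy c≢d
    rewrite cx | cy | ==ᶜ-≢ c≢d | ∧-zeroʳ (x + y ≤ᵇ n) = refl

  mono-mixed-sum : ∀ x y {c d} → colour s t x ≡ c → colour s t (x + y) ≡ d → c ≢ d →
                   count (isMonoSchur n s t x y) ≡ 0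
  mono-mixed-sum x y {c} cx cz c≢d
    rewrite cx | cz | ==ᶜ-≢ c≢d | ∧-zeroʳ (c ==ᶜ colour s t y) | ∧-zeroʳ (x + y ≤ᵇ n) = refl

∸-swap : ∀ m a b → m ∸ a ∸ b ≡ m ∸ b ∸ a
∸-swap m a b = trans (∸-+-assoc m a b) (trans (cong (m ∸_) (+-comm a b)) (sym (∸-+-assoc m b a)))

within : ∀ {a b i} → a ≤ b → i ≤ a + (b ∸ a) → i ≤ b
within a≤b i≤ = ≤-trans i≤ (≤-reflexive (m+[n∸m]≡n a≤b))

module Rows (n s t : ℕ) (s≤t : s ≤ t) (t≤n : t ≤ n) (2s≤t : 2 * s ≤ t) (n-t≤s : n ∸ t ≤ s) where

  open Triples n s t

  s+s≤t : s + s ≤ t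
  s+s≤t = ≤-trans (≤-reflexive (cong (s +_) (sym (+-identityʳ s)))) 2s≤t

  n≤t+s : n ≤ t + s
  n≤t+s = ≤-trans (m≤n+m∸n n t) (+-monoʳ-≤ t n-t≤s)

  g : ℕ → ℕ → ℕ
  g x y = count (isMonoSchur n s t x y)

  row : ℕ → ℕ
  row x = Σ⟨ 0 , n ⟩ g x

  blocks : ∀ (f : ℕ → ℕ) → Σ⟨ 0 , n ⟩ f ≡ (Σ⟨ 0 , s ⟩ f + Σ⟨ s , t ∸ s ⟩ f) + Σ⟨ t , n ∸ t ⟩ f
  blocks f = trans (Σ-split 0 n t f t≤n)
                   (cong (_+ Σ⟨ t , n ∸ t ⟩ f) (Σ-split 0 t s f s≤t))

  -- x ∈ L: partners y ∈ L with x + y ≤ s (beyond s the sum is blue, as 2s ≤ t)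
  -- and y ∈ H with x + y ≤ n.
  row-low : ∀ x → 0 < x → x ≤ s → row x ≡ (s ∸ x) + (n ∸ t ∸ x)
  row-low x _ x≤s = begin
    row x                                                       ≡⟨ blocks (g x) ⟩
    (Σ⟨ 0 , s ⟩ g x + Σ⟨ s , t ∸ s ⟩ g x) + Σ⟨ t , n ∸ t ⟩ g x  ≡⟨ cong₂ _+_ (cong₂ _+_ low mid) high ⟩
    (s ∸ x + 0) + (n ∸ x ∸ t)                                   ≡⟨ cong₂ _+_ (+-identityʳ (s ∸ x)) (∸-swap n x t) ⟩
    (s ∸ x) + (n ∸ t ∸ x)                                       ∎
    where
    open ≡-Reasoning
    red : colour s t x ≡ R
    red = colour-low x≤s
    low : Σ⟨ 0 , s ⟩ g x ≡ s ∸ x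
    low = row-count x s 0 s (g x) (m∸n≤m s x)
      (λ y _ y≤s x+y≤s → mono-yes x y (≤-trans x+y≤s (≤-trans s≤t t≤n))
                           red (colour-low y≤s) (colour-low x+y≤s))
      (λ y _ y≤s s<x+y → mono-mixed-sum x y red
                           (colour-mid s<x+y (≤-trans (+-mono-≤ x≤s y≤s) s+s≤t)) R≢B)
    mid : Σ⟨ s , t ∸ s ⟩ g x ≡ 0
    mid = Σ-zero s (t ∸ s) (g x) (λ y s<y y≤ →
      mono-mixed-summands x y red (colour-mid s<y (within s≤t y≤)) R≢B)
    high : Σ⟨ t , n ∸ t ⟩ g x ≡ n ∸ x ∸ t
    high = row-count x n t (n ∸ t) (g x) (≤-trans (m∸n≤m n x) (≤-reflexive (sym (m+[n∸m]≡n t≤n))))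
      (λ y t<y _ x+y≤n → mono-yes x y x+y≤n red (colour-high s≤t t<y)
                           (colour-high s≤t (<-≤-trans t<y (m≤n+m y x))))
      (λ y _ _ n<x+y → mono-too-big x y n<x+y)

  -- x ∈ C: partners y ∈ C with x + y ≤ t.
  row-mid : ∀ x → s < x → x ≤ t → row x ≡ t ∸ s ∸ x
  row-mid x s<x x≤t = begin
    row x                                                       ≡⟨ blocks (g x) ⟩
    (Σ⟨ 0 , s ⟩ g x + Σ⟨ s , t ∸ s ⟩ g x) + Σ⟨ t , n ∸ t ⟩ g x  ≡⟨ cong₂ _+_ (cong₂ _+_ low mid) high ⟩
    (0 + (t ∸ x ∸ s)) + 0                                       ≡⟨ +-identityʳ (t ∸ x ∸ s) ⟩
    t ∸ x ∸ s                                                   ≡⟨ ∸-swap t x s ⟩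
    t ∸ s ∸ x                                                   ∎
    where
    open ≡-Reasoning
    blue : colour s t x ≡ B
    blue = colour-mid s<x x≤t
    low : Σ⟨ 0 , s ⟩ g x ≡ 0
    low = Σ-zero 0 s (g x) (λ y _ y≤s →
      mono-mixed-summands x y blue (colour-low y≤s) B≢R)
    mid : Σ⟨ s , t ∸ s ⟩ g x ≡ t ∸ x ∸ s
    mid = row-count x t s (t ∸ s) (g x) (≤-trans (m∸n≤m t x) (≤-reflexive (sym (m+[n∸m]≡n s≤t))))
      (λ y s<y y≤ x+y≤t → mono-yes x y (≤-trans x+y≤t t≤n) blue
                            (colour-mid s<y (within s≤t y≤))
                            (colour-mid (<-≤-trans s<x (m≤m+n x y)) x+y≤t))
      (λ y _ _ t<x+y → mono-mixed-sum x y blue (colour-high s≤t t<x+y) B≢R)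
    high : Σ⟨ t , n ∸ t ⟩ g x ≡ 0
    high = Σ-zero t (n ∸ t) (g x) (λ y t<y _ →
      mono-mixed-summands x y blue (colour-high s≤t t<y) B≢R)

  -- x ∈ H: partners y ∈ L with x + y ≤ n; two elements of H sum beyond t + s ≥ n.
  row-high : ∀ x → t < x → x ≤ n → row x ≡ n ∸ x
  row-high x t<x x≤n = begin
    row x                                                       ≡⟨ blocks (g x) ⟩
    (Σ⟨ 0 , s ⟩ g x + Σ⟨ s , t ∸ s ⟩ g x) + Σ⟨ t , n ∸ t ⟩ g x  ≡⟨ cong₂ _+_ (cong₂ _+_ low mid) high ⟩
    (n ∸ x + 0) + 0                                             ≡⟨ +-identityʳ _ ⟩
    n ∸ x + 0                                                   ≡⟨ +-identityʳ _ ⟩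
    n ∸ x                                                       ∎
    where
    open ≡-Reasoning
    red : colour s t x ≡ R
    red = colour-high s≤t t<x
    low : Σ⟨ 0 , s ⟩ g x ≡ n ∸ x
    low = row-count x n 0 s (g x) (≤-trans (∸-monoʳ-≤ n (<⇒≤ t<x)) n-t≤s)
      (λ y _ y≤s x+y≤n → mono-yes x y x+y≤n red (colour-low y≤s)
                           (colour-high s≤t (<-≤-trans t<x (m≤m+n x y))))
      (λ y _ _ n<x+y → mono-too-big x y n<x+y)
    mid : Σ⟨ s , t ∸ s ⟩ g x ≡ 0
    mid = Σ-zero s (t ∸ s) (g x) (λ y s<y y≤ →
      mono-mixed-summands x y red (colour-mid s<y (within s≤t y≤)) R≢B)
    high : Σ⟨ t , n ∸ t ⟩ g x ≡ 0
    high = Σ-zero t (n ∸ t) (g x) (λ y t<y _ → mono-too-big x y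
      (≤-<-trans n≤t+s (<-≤-trans (+-monoʳ-< t (≤-<-trans s≤t t<y)) (+-monoˡ-≤ y (<⇒≤ t<x)))))

  Σ-rows : Σ⟨ 0 , n ⟩ row ≡ ((tri s + tri (n ∸ t)) + tri (t ∸ s ∸ s)) + tri (n ∸ t)
  Σ-rows = trans (blocks row) (cong₂ _+_ (cong₂ _+_ sum-low sum-mid) sum-high)
    where
    sum-low : Σ⟨ 0 , s ⟩ row ≡ tri s + tri (n ∸ t)
    sum-low = trans (Σ-cong 0 s row _ row-low)
      (trans (Σ-+ 0 s (s ∸_) (n ∸ t ∸_))
             (cong₂ _+_ (Σ-decreasing 0 s s ≤-refl) (Σ-decreasing 0 s (n ∸ t) n-t≤s)))
    sum-mid : Σ⟨ s , t ∸ s ⟩ row ≡ tri (t ∸ s ∸ s)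
    sum-mid = trans (Σ-cong s (t ∸ s) row _ (λ x s<x x≤ → row-mid x s<x (within s≤t x≤)))
                    (Σ-decreasing s (t ∸ s) (t ∸ s) (m≤n+m (t ∸ s) s))
    sum-high : Σ⟨ t , n ∸ t ⟩ row ≡ tri (n ∸ t)
    sum-high = trans (Σ-cong t (n ∸ t) row _ (λ x t<x x≤ → row-high x t<x (within t≤n x≤)))
                     (Σ-decreasing t (n ∸ t) n (m≤n+m∸n n t))

  M-as-Σ : M n s t ≡ Σ⟨ 0 , n ⟩ row
  M-as-Σ = trans (sum-applyUpTo n 0 _ suc (λ _ → refl))
                 (Σ-cong 0 n _ row (λ x _ _ → sum-applyUpTo n 0 (g x) suc (λ _ → refl)))

closed-form : ∀ s t c → ((tri s + tri c) + tri (t ∸ s ∸ s)) + tri c ≡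
              (s * (s ∸ 1)) / 2 + ((t ∸ 2 * s) * (t ∸ 2 * s ∸ 1)) / 2 + c * (c ∸ 1)
closed-form s t c = begin
  ((tri s + tri c) + tri (t ∸ s ∸ s)) + tri c  ≡⟨ regroup (tri s) (tri c) (tri (t ∸ s ∸ s)) ⟩
  (tri s + tri (t ∸ s ∸ s)) + (tri c + tri c)  ≡⟨ cong₂ _+_ (cong₂ _+_ (sym (tri-half s)) middle) (tri-double c) ⟩
  (s * (s ∸ 1)) / 2 + ((t ∸ 2 * s) * (t ∸ 2 * s ∸ 1)) / 2 + c * (c ∸ 1) ∎
  where
  open ≡-Reasoning
  regroup : ∀ a b d → ((a + b) + d) + b ≡ (a + d) + (b + b)
  regroup = solve 3 (λ a b d → ((a :+ b) :+ d) :+ b := (a :+ d) :+ (b :+ b)) refl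
  t-2s : t ∸ s ∸ s ≡ t ∸ 2 * s
  t-2s = trans (∸-+-assoc t s s) (cong (λ z → t ∸ (s + z)) (sym (+-identityʳ s)))
  middle : tri (t ∸ s ∸ s) ≡ ((t ∸ 2 * s) * (t ∸ 2 * s ∸ 1)) / 2
  middle = trans (cong tri t-2s) (sym (tri-half (t ∸ 2 * s)))

-- The theorem: the three blocks contribute s(s-1)/2, (t-2s)(t-2s-1)/2 and (n-t)(n-t-1).
lemma1 : (n s t : ℕ) → 1 ≤ s → s ≤ t → t ≤ n → 2 * s ≤ t → n ∸ t ≤ s →
    M n s t ≡ (s * (s ∸ 1)) / 2 + ((t ∸ 2 * s) * (t ∸ 2 * s ∸ 1)) / 2 + (n ∸ t) * (n ∸ t ∸ 1)
lemma1 n s t _ s≤t t≤n 2s≤t n-t≤s = begin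
  M n s t                     ≡⟨ M-as-Σ ⟩
  Σ⟨ 0 , n ⟩ row              ≡⟨ Σ-rows ⟩
  ((tri s + tri (n ∸ t)) + tri (t ∸ s ∸ s)) + tri (n ∸ t)  ≡⟨ closed-form s t (n ∸ t) ⟩
  (s * (s ∸ 1)) / 2 + ((t ∸ 2 * s) * (t ∸ 2 * s ∸ 1)) / 2 + (n ∸ t) * (n ∸ t ∸ 1) ∎
  where
  open ≡-Reasoning
  open Rows n s t s≤t t≤n 2s≤t n-t≤s
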